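{- Let $k \geq s \geq t \geq 2$ be integers and let $\pi = (P_1,P_2,\dots,P_s)$ be a partition of $[k]$ into $s$ nonempty parts. (i) If $\pi'$ is a refinement of $\pi$ with $|\pi'| = s+1$ parts, then $f(\pi,t) \leq f(\pi',t)$. (ii) If $|P_1| \geq |P_2| \geq 2$ and $a \in P_2$, and $\pi'$ is the partition $(P_1',P_2',\dots,P_s')$ of $[k]$ with $P_1' = (P_1 \cup P_2) \setminus \{a\}$, $P_2' = \{a\}$ and $P_i' = P_i$ for $3 \leq i \leq s$, then $f(\pi',t) \leq f(\pi, t)$.
   Context: For a set partition $\pi = (P_1,\dots,P_s)$ of $[k]$ with parts indexed by $[s]$, $|\pi| = s$ denotes the number of parts, and \[ f(\pi, t) = \sum_{T \subseteq [s],\ |T| = t}\ \prod_{i \in T} |P_i|. \] -}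

module Defs where

open import Data.Nat using (ℕ; zero; suc; _≟_; _≤_)
open import Data.Bool using (Bool; true; false)
open import Data.Fin using (Fin; toℕ)
import Data.Fin as Fin
open import Data.Fin.Subset using (Subset; _∈_; ∣_∣)
open import Data.Fin.Subset.Properties using (_∈?_)
open import Data.Vec using (Vec; []; _∷_)
open import Data.List using (List; []; _∷_; map; filter; allFin; length; _++_)
open import Data.Nat.ListAction using (sum; product)
open import Data.Sum using (_⊎_)
open import Data.Product using (∃; _×_)
open import Relation.Binary.PropositionalEquality using (_≡_; _≢_)

-- A set partition π = (P_1,…,P_s) of [k] (= Fin k) with parts indexed by Fin s
-- (index i ↔ part P_{i+1}) is encoded by its labelling c : Fin k → Fin s,
-- P_i = { x | c x ≡ i }.
IsPartition : {k s : ℕ} → (Fin k → Fin s) → Set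
IsPartition {k} {s} c = ∀ (i : Fin s) → ∃ λ (x : Fin k) → c x ≡ i

partSize : {k s : ℕ} → (Fin k → Fin s) → Fin s → ℕ
partSize {k} c i = length (filter (λ x → Fin._≟_ (c x) i) (allFin k))

allSubsets : (n : ℕ) → List (Subset n)
allSubsets zero = [] ∷ []
allSubsets (suc n) = map (true ∷_) (allSubsets n) ++ map (false ∷_) (allSubsets n)

f : {k s : ℕ} → (Fin k → Fin s) → ℕ → ℕ
f {k} {s} c t =
  sum (map (λ T → product (map (partSize c) (filter (_∈? T) (allFin s))))
           (filter (λ T → ∣ T ∣ ≟ t) (allSubsets s)))

Refines : {k s s' : ℕ} → (Fin k → Fin s') → (Fin k → Fin s) → Set
Refines {k} c' c = ∀ (x y : Fin k) → c' x ≡ c' y → c x ≡ c y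

-- c' is the partition (P_1', …, P_s') with P_1' = (P_1 ∪ P_2) ∖ {a}, P_2' = {a},
-- P_i' = P_i for i ≥ 3 (indices 0-based: P_1 ↔ toℕ i ≡ 0, P_2 ↔ toℕ i ≡ 1).
IsMove : {k s : ℕ} → (Fin k → Fin s) → Fin k → (Fin k → Fin s) → Set
IsMove {k} {s} c a c' = ∀ (x : Fin k) →
  (x ≡ a → toℕ (c' x) ≡ 1) ×
  (x ≢ a → (toℕ (c x) ≡ 0 ⊎ toℕ (c x) ≡ 1) → toℕ (c' x) ≡ 0) ×
  (x ≢ a → 2 ≤ toℕ (c x) → c' x ≡ c x)

module Submission where

-- f(π, t) is the elementary symmetric polynomial e_t of the part sizes.  Writing
-- e_t(x, y, r) = x y e_{t-2}(r) + (x + y) e_{t-1}(r) + e_t(r) shows that merging two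
-- variables into x + y loses exactly the terms containing x y, so e_t can only drop when
-- parts are merged; since π is obtained from π' by merging parts, this gives (i).  For (ii)
-- the same expansion in |P_1|, |P_2| applies: the move keeps |P_1| + |P_2| and replaces the
-- product |P_1| |P_2| by |P_1| + |P_2| - 1, which is not larger.

open import Defs
open import Data.Bool using (Bool; true; false)
open import Data.Empty using (⊥-elim)
open import Data.Fin using (Fin; toℕ) renaming (zero to fzero; suc to fsuc)
open import Data.Fin.Properties
  using (¬Fin0; punchInᵢ≢i; toℕ-injective) renaming (_≟_ to _≟F_; suc-injective to fsuc-injective)
open import Data.Fin.Subset using (Subset; ∣_∣)
open import Data.Fin.Subset.Properties using (_∈?_; drop-there)
open import Data.List using (List; []; _∷_; map; filter; allFin; tabulate; length; _++_)
open import Data.List.Properties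
  using (filter-++; filter-≐; filter-none; filter-all; length-tabulate; map-++; map-∘; map-cong; map-tabulate)
open import Data.List.Relation.Unary.All using (universal)
open import Data.Nat using (ℕ; zero; suc; _+_; _*_; _≤_; z≤n; s≤s; s≤s⁻¹; _≟_)
open import Data.Nat.ListAction using (sum; product)
open import Data.Nat.ListAction.Properties using (sum-++)
open import Data.Nat.Properties
  using (≤-refl; ≤-trans; ≤-reflexive; +-mono-≤; +-monoˡ-≤; +-monoʳ-≤; *-monoʳ-≤; *-monoˡ-≤; m≤n+m; m≤m*n;
         +-comm; +-assoc; +-identityʳ; +-cancelʳ-≡; *-identityˡ; *-identityʳ; *-zeroʳ; *-distribˡ-+; *-distribʳ-+;
         suc-injective; +-commutativeSemigroup; module ≤-Reasoning)
open import Algebra.Properties.CommutativeSemigroup +-commutativeSemigroup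
  using () renaming (interchange to +-interchange)
open import Data.Nat.Tactic.RingSolver using (solve-∀)
open import Data.Product using (_,_; _×_; proj₁; proj₂; ∃)
open import Data.Sum using (inj₁; inj₂)
open import Data.Vec using (_∷_; there)
open import Data.Vec.Functional using (removeAt)
open import Function using (_∘_; case_of_)
open import Level using (Level)
open import Relation.Binary.PropositionalEquality
open import Relation.Nullary using (does; yes; no)
open import Relation.Nullary.Decidable using (dec-true; dec-false)
open import Relation.Unary using (Pred; Decidable; _≐_)

filter-map : {ℓ : Level} {A B : Set} {P : Pred B ℓ} (P? : Decidable P) (h : A → B) (xs : List A) →
  filter P? (map h xs) ≡ map h (filter (P? ∘ h) xs)
filter-map P? h [] = refl
filter-map P? h (x ∷ xs) with does (P? (h x))
... | true = cong (h x ∷_) (filter-map P? h xs)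
... | false = filter-map P? h xs

sum-map-filter-map : {ℓ : Level} {A B : Set} {P : Pred B ℓ} (h : B → ℕ) (P? : Decidable P) (f : A → B) (xs : List A) →
  sum (map h (filter P? (map f xs))) ≡ sum (map (h ∘ f) (filter (P? ∘ f) xs))
sum-map-filter-map h P? f xs =
  trans (cong (sum ∘ map h) (filter-map P? f xs)) (cong sum (sym (map-∘ (filter (P? ∘ f) xs))))

sum-map-*ˡ : {A : Set} (n : ℕ) (h : A → ℕ) (xs : List A) →
  sum (map (λ x → n * h x) xs) ≡ n * sum (map h xs)
sum-map-*ˡ n h [] = sym (*-zeroʳ n)
sum-map-*ˡ n h (x ∷ xs) = trans (cong (n * h x +_) (sum-map-*ˡ n h xs)) (sym (*-distribˡ-+ n (h x) _))

indicator : Bool → ℕ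
indicator false = 0
indicator true = 1

length-filter-∷ : {ℓ : Level} {A : Set} {P : Pred A ℓ} (P? : Decidable P) (x : A) (xs : List A) →
  length (filter P? (x ∷ xs)) ≡ indicator (does (P? x)) + length (filter P? xs)
length-filter-∷ P? x xs with does (P? x)
... | true = refl
... | false = refl

filter-tabulate-suc : {ℓ : Level} {k : ℕ} {P : Pred (Fin (suc k)) ℓ} (P? : Decidable P) →
  filter P? (tabulate fsuc) ≡ map fsuc (filter (P? ∘ fsuc) (allFin k))
filter-tabulate-suc {k = k} P? = trans (cong (filter P?) (sym (map-tabulate (λ i → i) fsuc))) (filter-map P? fsuc (allFin k))

filter-≟-allFin : {k : ℕ} (a : Fin k) → filter (_≟F a) (allFin k) ≡ a ∷ []
filter-≟-allFin {suc k} fzero =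
  cong (fzero ∷_) (trans (filter-tabulate-suc (_≟F fzero)) (cong (map fsuc) (filter-none _ (universal (λ _ ()) (allFin k)))))
filter-≟-allFin {suc k} (fsuc a) = begin
    filter (_≟F fsuc a) (tabulate fsuc)
  ≡⟨ filter-tabulate-suc (_≟F fsuc a) ⟩
    map fsuc (filter ((_≟F fsuc a) ∘ fsuc) (allFin k))
  ≡⟨ cong (map fsuc) (filter-≐ _ (_≟F a) (fsuc-injective , cong fsuc) (allFin k)) ⟩
    map fsuc (filter (_≟F a) (allFin k))
  ≡⟨ cong (map fsuc) (filter-≟-allFin a) ⟩
    fsuc a ∷ [] ∎
  where open ≡-Reasoning

m+n≡1+b⇒b≤m*n : {m n b : ℕ} → 1 ≤ m → 1 ≤ n → m + n ≡ suc b → b ≤ m * n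
m+n≡1+b⇒b≤m*n {suc p} {suc q} {b} _ _ eq = begin
    b          ≡⟨ suc-injective eq ⟨
    p + suc q  ≡⟨ +-comm p (suc q) ⟩
    suc q + p  ≤⟨ +-monoʳ-≤ (suc q) (m≤m*n p (suc q)) ⟩
    suc q + p * suc q ∎
  where open ≤-Reasoning

esym : {s : ℕ} → (Fin s → ℕ) → ℕ → ℕ
esym g zero = 1
esym {zero} g (suc t) = 0
esym {suc s} g (suc t) = g fzero * esym (g ∘ fsuc) t + esym (g ∘ fsuc) (suc t)

esym-cong : {s : ℕ} {g h : Fin s → ℕ} → g ≗ h → (t : ℕ) → esym g t ≡ esym h t
esym-cong eq zero = refl
esym-cong {zero} eq (suc t) = refl
esym-cong {suc s} eq (suc t) =
  cong₂ _+_ (cong₂ _*_ (eq fzero) (esym-cong (eq ∘ fsuc) t)) (esym-cong (eq ∘ fsuc) (suc t))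

esym-zeros : {s : ℕ} (t : ℕ) → esym {s} (λ _ → 0) (suc t) ≡ 0
esym-zeros {zero} t = refl
esym-zeros {suc s} t = esym-zeros {s} t

esym-removeAt : {s : ℕ} (g : Fin (suc s) → ℕ) (i : Fin (suc s)) (t : ℕ) →
  esym g (suc t) ≡ g i * esym (removeAt g i) t + esym (removeAt g i) (suc t)
esym-removeAt g fzero t = refl
esym-removeAt {suc s} g (fsuc i) zero =
  trans (cong (g fzero * 1 +_) (esym-removeAt (g ∘ fsuc) i zero)) (interchange₀ (g fzero) (g (fsuc i)) _)
  where
  interchange₀ : (x y b : ℕ) → x * 1 + (y * 1 + b) ≡ y * 1 + (x * 1 + b)
  interchange₀ = solve-∀
esym-removeAt {suc s} g (fsuc i) (suc t) =
  trans (cong₂ (λ p q → g fzero * p + q) (esym-removeAt (g ∘ fsuc) i t) (esym-removeAt (g ∘ fsuc) i (suc t)))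
        (interchange (g fzero) (g (fsuc i)) _ _ _)
  where
  interchange : (x y a b c : ℕ) → x * (y * a + b) + (y * b + c) ≡ y * (x * a + b) + (x * b + c)
  interchange = solve-∀

esym-removeAt-≤ : {s : ℕ} (g : Fin (suc s) → ℕ) (i : Fin (suc s)) (t : ℕ) → esym (removeAt g i) t ≤ esym g t
esym-removeAt-≤ g i zero = ≤-refl
esym-removeAt-≤ g i (suc t) = ≤-trans (m≤n+m _ _) (≤-reflexive (sym (esym-removeAt g i t)))

module _ {s : ℕ} (g : Fin (suc (suc s)) → ℕ) where

  private
    r : Fin s → ℕ
    r = g ∘ fsuc ∘ fsuc

  esym-1-heads : esym g 1 ≡ (g fzero + g (fsuc fzero)) * 1 + esym r 1
  esym-1-heads = expand (g fzero) (g (fsuc fzero)) (esym r 1)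
    where
    expand : (x y c : ℕ) → x * 1 + (y * 1 + c) ≡ (x + y) * 1 + c
    expand = solve-∀

  esym-2+-heads : (t : ℕ) →
    esym g (2 + t) ≡ (g fzero * g (fsuc fzero)) * esym r t + ((g fzero + g (fsuc fzero)) * esym r (1 + t) + esym r (2 + t))
  esym-2+-heads t = expand (g fzero) (g (fsuc fzero)) (esym r t) (esym r (1 + t)) (esym r (2 + t))
    where
    expand : (x y a b c : ℕ) → x * (y * a + b) + (y * b + c) ≡ (x * y) * a + ((x + y) * b + c)
    expand = solve-∀

esym-heads-mono : {s : ℕ} (g h : Fin (suc (suc s)) → ℕ) → h ∘ fsuc ∘ fsuc ≗ g ∘ fsuc ∘ fsuc →
  h fzero + h (fsuc fzero) ≡ g fzero + g (fsuc fzero) → h fzero * h (fsuc fzero) ≤ g fzero * g (fsuc fzero) →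
  (t : ℕ) → esym h t ≤ esym g t
esym-heads-mono g h tails sums products zero = ≤-refl
esym-heads-mono g h tails sums products (suc zero) = ≤-reflexive (begin
    esym h 1                                  ≡⟨ esym-1-heads h ⟩
    (h₀ + h₁) * 1 + esym (h ∘ fsuc ∘ fsuc) 1  ≡⟨ cong₂ (λ x y → x * 1 + y) sums (esym-cong tails 1) ⟩
    (g₀ + g₁) * 1 + esym (g ∘ fsuc ∘ fsuc) 1  ≡⟨ esym-1-heads g ⟨
    esym g 1                                  ∎)
  where
  open ≡-Reasoning
  g₀ = g fzero; g₁ = g (fsuc fzero); h₀ = h fzero; h₁ = h (fsuc fzero)

esym-heads-mono g h tails sums products (suc (suc t)) = begin
    esym h (2 + t)
  ≡⟨ esym-2+-heads h t ⟩
    (h₀ * h₁) * esym rₕ t + ((h₀ + h₁) * esym rₕ (1 + t) + esym rₕ (2 + t))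
  ≡⟨ cong₂ (λ x y → (h₀ * h₁) * x + y) (esym-cong tails t)
           (cong₂ _+_ (cong₂ _*_ sums (esym-cong tails (1 + t))) (esym-cong tails (2 + t))) ⟩
    (h₀ * h₁) * esym r t + ((g₀ + g₁) * esym r (1 + t) + esym r (2 + t))
  ≤⟨ +-monoˡ-≤ _ (*-monoˡ-≤ (esym r t) products) ⟩
    (g₀ * g₁) * esym r t + ((g₀ + g₁) * esym r (1 + t) + esym r (2 + t))
  ≡⟨ esym-2+-heads g t ⟨
    esym g (2 + t) ∎
  where
  open ≤-Reasoning
  g₀ = g fzero; g₁ = g (fsuc fzero); h₀ = h fzero; h₁ = h (fsuc fzero)
  r = g ∘ fsuc ∘ fsuc; rₕ = h ∘ fsuc ∘ fsuc

hasSize : {s : ℕ} (t : ℕ) → Decidable (λ (T : Subset s) → ∣ T ∣ ≡ t)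
hasSize t T = ∣ T ∣ ≟ t

productOver : {s : ℕ} → (Fin s → ℕ) → Subset s → ℕ
productOver {s} g T = product (map g (filter (_∈? T) (allFin s)))

sumOfProducts : {s : ℕ} → (Fin s → ℕ) → ℕ → ℕ
sumOfProducts {s} g t = sum (map (productOver g) (filter (hasSize t) (allSubsets s)))

filter-∈?-∷ : {s : ℕ} (b : Bool) (T : Subset s) →
  filter (_∈? (b ∷ T)) (tabulate fsuc) ≡ map fsuc (filter (_∈? T) (allFin s))
filter-∈?-∷ {s} b T =
  trans (filter-tabulate-suc (_∈? (b ∷ T))) (cong (map fsuc) (filter-≐ _ (_∈? T) (drop-there , there) (allFin s)))

productOver-tail : {s : ℕ} (g : Fin (suc s) → ℕ) (b : Bool) (T : Subset s) →
  product (map g (filter (_∈? (b ∷ T)) (tabulate fsuc))) ≡ productOver (g ∘ fsuc) T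
productOver-tail g b T =
  trans (cong (product ∘ map g) (filter-∈?-∷ b T)) (cong product (sym (map-∘ (filter (_∈? T) (allFin _)))))

module _ {s : ℕ} (g : Fin (suc s) → ℕ) where

  private
    sumOver : Bool → ℕ → ℕ
    sumOver b t = sum (map (productOver g) (filter (hasSize t) (map (b ∷_) (allSubsets s))))

  sumOfProducts-split : (t : ℕ) → sumOfProducts g t ≡ sumOver true t + sumOver false t
  sumOfProducts-split t = begin
      total′ (filter (hasSize t) (map (true ∷_) A ++ map (false ∷_) A))
    ≡⟨ cong total′ (filter-++ (hasSize t) (map (true ∷_) A) _) ⟩
      total′ (filter (hasSize t) (map (true ∷_) A) ++ filter (hasSize t) (map (false ∷_) A))
    ≡⟨ trans (cong sum (map-++ (productOver g) (filter (hasSize t) (map (true ∷_) A)) _)) (sum-++ (map (productOver g) (filter (hasSize t) (map (true ∷_) A))) _) ⟩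
      sumOver true t + sumOver false t ∎
    where
    open ≡-Reasoning
    A = allSubsets s
    total′ : List (Subset (suc s)) → ℕ
    total′ = sum ∘ map (productOver g)

  sumOver-outside : (t : ℕ) → sumOver false t ≡ sumOfProducts (g ∘ fsuc) t
  sumOver-outside t =
    trans (sum-map-filter-map (productOver g) (hasSize t) (false ∷_) (allSubsets s))
          (cong sum (map-cong (productOver-tail g false) (filter (hasSize t) (allSubsets s))))

  sumOver-inside-zero : sumOver true 0 ≡ 0
  sumOver-inside-zero =
    trans (sum-map-filter-map (productOver g) (hasSize 0) (true ∷_) (allSubsets s))
          (cong (sum ∘ map _) (filter-none (hasSize 0 ∘ (true ∷_)) (universal (λ _ ()) (allSubsets s))))

  sumOver-inside-suc : (t : ℕ) → sumOver true (suc t) ≡ g fzero * sumOfProducts (g ∘ fsuc) t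
  sumOver-inside-suc t = begin
      sumOver true (suc t)
    ≡⟨ sum-map-filter-map (productOver g) (hasSize (suc t)) (true ∷_) (allSubsets s) ⟩
      sum (map (productOver g ∘ (true ∷_)) (filter (hasSize (suc t) ∘ (true ∷_)) (allSubsets s)))
    ≡⟨ cong (sum ∘ map _) (filter-≐ _ (hasSize t) (suc-injective , cong suc) (allSubsets s)) ⟩
      sum (map (productOver g ∘ (true ∷_)) (filter (hasSize t) (allSubsets s)))
    ≡⟨ cong sum (map-cong (λ T → cong (g fzero *_) (productOver-tail g true T)) (filter (hasSize t) (allSubsets s))) ⟩
      sum (map (λ T → g fzero * productOver (g ∘ fsuc) T) (filter (hasSize t) (allSubsets s)))
    ≡⟨ sum-map-*ˡ (g fzero) (productOver (g ∘ fsuc)) (filter (hasSize t) (allSubsets s)) ⟩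
      g fzero * sumOfProducts (g ∘ fsuc) t ∎
    where open ≡-Reasoning

  sumOfProducts-zero : sumOfProducts g 0 ≡ sumOfProducts (g ∘ fsuc) 0
  sumOfProducts-zero = trans (sumOfProducts-split 0) (cong₂ _+_ sumOver-inside-zero (sumOver-outside 0))

  sumOfProducts-suc : (t : ℕ) →
    sumOfProducts g (suc t) ≡ g fzero * sumOfProducts (g ∘ fsuc) t + sumOfProducts (g ∘ fsuc) (suc t)
  sumOfProducts-suc t = trans (sumOfProducts-split (suc t)) (cong₂ _+_ (sumOver-inside-suc t) (sumOver-outside (suc t)))

sumOfProducts≡esym : {s : ℕ} (g : Fin s → ℕ) (t : ℕ) → sumOfProducts g t ≡ esym g t
sumOfProducts≡esym {zero} g zero = refl
sumOfProducts≡esym {zero} g (suc t) = refl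
sumOfProducts≡esym {suc s} g zero = trans (sumOfProducts-zero g) (sumOfProducts≡esym (g ∘ fsuc) zero)
sumOfProducts≡esym {suc s} g (suc t) = trans (sumOfProducts-suc g t)
  (cong₂ (λ x y → g fzero * x + y) (sumOfProducts≡esym (g ∘ fsuc) t) (sumOfProducts≡esym (g ∘ fsuc) (suc t)))

f≡esym : {k s : ℕ} (c : Fin k → Fin s) (t : ℕ) → f c t ≡ esym (partSize c) t
f≡esym c = sumOfProducts≡esym (partSize c)

fibreSum : {m s : ℕ} → (Fin m → Fin s) → (Fin m → ℕ) → Fin s → ℕ
fibreSum {zero} φ G i = 0
fibreSum {suc m} φ G i = G fzero * indicator (does (φ fzero ≟F i)) + fibreSum (φ ∘ fsuc) (G ∘ fsuc) i

fibreSum-zeros : {m s : ℕ} (φ : Fin m → Fin s) (i : Fin s) → fibreSum φ (λ _ → 0) i ≡ 0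
fibreSum-zeros {zero} φ i = refl
fibreSum-zeros {suc m} φ i = fibreSum-zeros (φ ∘ fsuc) i

fibreSum-cong : {m s : ℕ} (φ : Fin m → Fin s) {G H : Fin m → ℕ} → G ≗ H → fibreSum φ G ≗ fibreSum φ H
fibreSum-cong {zero} φ eq i = refl
fibreSum-cong {suc m} φ eq i =
  cong₂ (λ x y → x * indicator (does (φ fzero ≟F i)) + y) (eq fzero) (fibreSum-cong (φ ∘ fsuc) (eq ∘ fsuc) i)

fibreSum-+ : {m s : ℕ} (φ : Fin m → Fin s) (G H : Fin m → ℕ) (i : Fin s) →
  fibreSum φ (λ j → G j + H j) i ≡ fibreSum φ G i + fibreSum φ H i
fibreSum-+ {zero} φ G H i = refl
fibreSum-+ {suc m} φ G H i = begin
    (G fzero + H fzero) * b + fibreSum φ′ (λ j → G (fsuc j) + H (fsuc j)) i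
  ≡⟨ cong₂ _+_ (*-distribʳ-+ b (G fzero) (H fzero)) (fibreSum-+ φ′ (G ∘ fsuc) (H ∘ fsuc) i) ⟩
    (G fzero * b + H fzero * b) + (fibreSum φ′ (G ∘ fsuc) i + fibreSum φ′ (H ∘ fsuc) i)
  ≡⟨ +-interchange (G fzero * b) (H fzero * b) _ _ ⟩
    fibreSum φ G i + fibreSum φ H i ∎
  where
  open ≡-Reasoning
  φ′ = φ ∘ fsuc
  b = indicator (does (φ fzero ≟F i))

fibreSum-indicator : {m s : ℕ} (φ : Fin m → Fin s) (z : Fin m) (i : Fin s) →
  fibreSum φ (λ j → indicator (does (z ≟F j))) i ≡ indicator (does (φ z ≟F i))
fibreSum-indicator φ fzero i =
  trans (cong (1 * indicator (does (φ fzero ≟F i)) +_) (fibreSum-zeros (φ ∘ fsuc) i))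
        (trans (+-identityʳ _) (*-identityˡ _))
fibreSum-indicator φ (fsuc z) i = fibreSum-indicator (φ ∘ fsuc) z i

module _ {m s : ℕ} (φ : Fin (suc m) → Fin s) (G : Fin (suc m) → ℕ) where

  fibreSum-image : fibreSum φ G (φ fzero) ≡ G fzero + fibreSum (φ ∘ fsuc) (G ∘ fsuc) (φ fzero)
  fibreSum-image = cong (_+ fibreSum (φ ∘ fsuc) (G ∘ fsuc) (φ fzero))
    (trans (cong (λ b → G fzero * indicator b) (dec-true (φ fzero ≟F φ fzero) refl)) (*-identityʳ (G fzero)))

  fibreSum-nonimage : {i : Fin s} → φ fzero ≢ i → fibreSum φ G i ≡ fibreSum (φ ∘ fsuc) (G ∘ fsuc) i
  fibreSum-nonimage {i} φ₀≢i = cong (_+ fibreSum (φ ∘ fsuc) (G ∘ fsuc) i)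
    (trans (cong (λ b → G fzero * indicator b) (dec-false (φ fzero ≟F i) φ₀≢i)) (*-zeroʳ (G fzero)))

esym-fibreSum-≤ : {m s : ℕ} (φ : Fin m → Fin s) (G : Fin m → ℕ) (t : ℕ) → esym (fibreSum φ G) t ≤ esym G t
esym-fibreSum-≤ φ G zero = ≤-refl
esym-fibreSum-≤ {zero} {s} φ G (suc t) = ≤-reflexive (esym-zeros {s} t)
esym-fibreSum-≤ {suc m} {zero} φ G (suc t) = ⊥-elim (¬Fin0 (φ fzero))
esym-fibreSum-≤ {suc m} {suc s} φ G (suc t) = begin
    esym S (suc t)
  ≡⟨ esym-removeAt S i₀ t ⟩
    S i₀ * esym (removeAt S i₀) t + esym (removeAt S i₀) (suc t)
  ≡⟨ cong₂ _+_ (cong₂ _*_ (fibreSum-image φ G) (esym-cong off-i₀ t)) (esym-cong off-i₀ (suc t)) ⟩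
    (G fzero + S′ i₀) * esym R t + esym R (suc t)
  ≡⟨ trans (cong (_+ esym R (suc t)) (*-distribʳ-+ (esym R t) (G fzero) (S′ i₀)))
           (+-assoc (G fzero * esym R t) (S′ i₀ * esym R t) (esym R (suc t))) ⟩
    G fzero * esym R t + (S′ i₀ * esym R t + esym R (suc t))
  ≡⟨ cong (G fzero * esym R t +_) (sym (esym-removeAt S′ i₀ t)) ⟩
    G fzero * esym R t + esym S′ (suc t)
  ≤⟨ +-mono-≤ (*-monoʳ-≤ (G fzero) (≤-trans (esym-removeAt-≤ S′ i₀ t) (esym-fibreSum-≤ (φ ∘ fsuc) (G ∘ fsuc) t)))
              (esym-fibreSum-≤ (φ ∘ fsuc) (G ∘ fsuc) (suc t)) ⟩
    esym G (suc t) ∎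
  where
  open ≤-Reasoning
  i₀ = φ fzero
  S = fibreSum φ G
  S′ = fibreSum (φ ∘ fsuc) (G ∘ fsuc)
  R = removeAt S′ i₀
  off-i₀ : removeAt S i₀ ≗ R
  off-i₀ j = fibreSum-nonimage φ G (punchInᵢ≢i i₀ j ∘ sym)

length-filter-∘ : {A : Set} {m s : ℕ} (φ : Fin m → Fin s) (c : A → Fin m) (xs : List A) (i : Fin s) →
  length (filter (λ x → φ (c x) ≟F i) xs) ≡ fibreSum φ (λ j → length (filter (λ x → c x ≟F j) xs)) i
length-filter-∘ φ c [] i = sym (fibreSum-zeros φ i)
length-filter-∘ φ c (x ∷ xs) i = begin
    length (filter (λ y → φ (c y) ≟F i) (x ∷ xs))
  ≡⟨ length-filter-∷ (λ y → φ (c y) ≟F i) x xs ⟩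
    indicator (does (φ (c x) ≟F i)) + length (filter (λ y → φ (c y) ≟F i) xs)
  ≡⟨ cong₂ _+_ (sym (fibreSum-indicator φ (c x) i)) (length-filter-∘ φ c xs i) ⟩
    fibreSum φ (λ j → indicator (does (c x ≟F j))) i + fibreSum φ (count xs) i
  ≡⟨ sym (fibreSum-+ φ _ _ i) ⟩
    fibreSum φ (λ j → indicator (does (c x ≟F j)) + count xs j) i
  ≡⟨ fibreSum-cong φ (λ j → sym (length-filter-∷ (λ y → c y ≟F j) x xs)) i ⟩
    fibreSum φ (count (x ∷ xs)) i ∎
  where
  open ≡-Reasoning
  count : List _ → Fin _ → ℕ
  count ys j = length (filter (λ y → c y ≟F j) ys)

partSize-∘ : {k m s : ℕ} (φ : Fin m → Fin s) (c : Fin k → Fin m) → partSize (φ ∘ c) ≗ fibreSum φ (partSize c)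
partSize-∘ {k} φ c = length-filter-∘ φ c (allFin k)

partSize-cong : {k s : ℕ} {c d : Fin k → Fin s} → c ≗ d → partSize c ≗ partSize d
partSize-cong {k} eq i =
  cong length (filter-≐ _ _ ((λ {x} → trans (sym (eq x))) , (λ {x} → trans (eq x))) (allFin k))

refines-factor : {k s m : ℕ} (c′ : Fin k → Fin m) (c : Fin k → Fin s) → IsPartition c′ → Refines c′ c →
  ∃ λ (φ : Fin m → Fin s) → c ≗ φ ∘ c′
refines-factor c′ c onto refines = c ∘ witness , λ x → refines x (witness (c′ x)) (sym (proj₂ (onto (c′ x))))
  where
  witness : Fin _ → Fin _
  witness j = proj₁ (onto j)

f-refinement-≤ : {k s m : ℕ} (t : ℕ) (c : Fin k → Fin s) (c′ : Fin k → Fin m) →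
  IsPartition c′ → Refines c′ c → f c t ≤ f c′ t
f-refinement-≤ t c c′ onto refines with refines-factor c′ c onto refines
... | φ , c≗φ∘c′ = begin
    f c t
  ≡⟨ f≡esym c t ⟩
    esym (partSize c) t
  ≡⟨ esym-cong (λ i → trans (partSize-cong c≗φ∘c′ i) (partSize-∘ φ c′ i)) t ⟩
    esym (fibreSum φ (partSize c′)) t
  ≤⟨ esym-fibreSum-≤ φ (partSize c′) t ⟩
    esym (partSize c′) t
  ≡⟨ f≡esym c′ t ⟨
    f c′ t ∎
  where open ≤-Reasoning

total : {n : ℕ} → (Fin n → ℕ) → ℕ
total {n} G = fibreSum {n} {1} (λ _ → fzero) G fzero

total-suc : {n : ℕ} (G : Fin (suc n) → ℕ) → total G ≡ G fzero + total (G ∘ fsuc)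
total-suc G = fibreSum-image (λ _ → fzero) G

total-partSize : {k n : ℕ} (c : Fin k → Fin n) → total (partSize c) ≡ k
total-partSize {k} c = begin
    total (partSize c)
  ≡⟨ partSize-∘ (λ _ → fzero) c fzero ⟨
    length (filter (λ _ → fzero ≟F fzero) (allFin k))
  ≡⟨ cong length (filter-all (λ _ → fzero ≟F fzero) (universal (λ _ → refl) (allFin k))) ⟩
    length (allFin k)
  ≡⟨ length-tabulate (λ i → i) ⟩
    k ∎
  where open ≡-Reasoning

mergeHeads : {s : ℕ} → Fin (suc (suc s)) → Fin (suc (suc s))
mergeHeads fzero = fzero
mergeHeads (fsuc fzero) = fzero
mergeHeads (fsuc (fsuc j)) = fsuc (fsuc j)

mergeHeads≢1 : {s : ℕ} (i : Fin (suc (suc s))) → mergeHeads i ≢ fsuc fzero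
mergeHeads≢1 fzero ()
mergeHeads≢1 (fsuc fzero) ()
mergeHeads≢1 (fsuc (fsuc j)) ()

mergeHeads≡2+ : {s : ℕ} (i : Fin (suc (suc s))) {j : Fin s} → mergeHeads i ≡ fsuc (fsuc j) → i ≡ fsuc (fsuc j)
mergeHeads≡2+ (fsuc (fsuc i)) eq = eq

module _ {k s : ℕ} (c c′ : Fin k → Fin (suc (suc s))) (a : Fin k) (ca : c a ≡ fsuc fzero) (move : IsMove c a c′) where

  c′-at-a : c′ a ≡ fsuc fzero
  c′-at-a = toℕ-injective (proj₁ (move a) refl)

  c′-off-a : {x : Fin k} → x ≢ a → c′ x ≡ mergeHeads (c x)
  c′-off-a {x} x≢a with c x in eq
  ... | fzero = toℕ-injective (proj₁ (proj₂ (move x)) x≢a (inj₁ (cong toℕ eq)))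
  ... | fsuc fzero = toℕ-injective (proj₁ (proj₂ (move x)) x≢a (inj₂ (cong toℕ eq)))
  ... | fsuc (fsuc j) = trans (proj₂ (proj₂ (move x)) x≢a (subst (λ i → 2 ≤ toℕ i) (sym eq) (s≤s (s≤s z≤n)))) eq

  c′≡1⇔≡a : (λ x → c′ x ≡ fsuc fzero) ≐ (_≡ a)
  c′≡1⇔≡a = to , λ { refl → c′-at-a }
    where
    to : ∀ {x} → c′ x ≡ fsuc fzero → x ≡ a
    to {x} c′x≡1 with x ≟F a
    ... | yes x≡a = x≡a
    ... | no x≢a = ⊥-elim (mergeHeads≢1 (c x) (trans (sym (c′-off-a x≢a)) c′x≡1))

  c′≡2+⇔c≡2+ : (j : Fin s) → (λ x → c′ x ≡ fsuc (fsuc j)) ≐ (λ x → c x ≡ fsuc (fsuc j))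
  c′≡2+⇔c≡2+ j = to , from
    where
    to : ∀ {x} → c′ x ≡ fsuc (fsuc j) → c x ≡ fsuc (fsuc j)
    to {x} c′x≡j with x ≟F a
    ... | yes refl = case trans (sym c′-at-a) c′x≡j of λ ()
    ... | no x≢a = mergeHeads≡2+ (c x) (trans (sym (c′-off-a x≢a)) c′x≡j)
    from : ∀ {x} → c x ≡ fsuc (fsuc j) → c′ x ≡ fsuc (fsuc j)
    from {x} cx≡j = trans (c′-off-a x≢a) (cong mergeHeads cx≡j)
      where
      x≢a : x ≢ a
      x≢a refl = case trans (sym ca) cx≡j of λ ()

  partSize-moved : partSize c′ (fsuc fzero) ≡ 1
  partSize-moved = trans (cong length (filter-≐ _ (_≟F a) c′≡1⇔≡a (allFin k))) (cong length (filter-≟-allFin a))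

  partSize-untouched : partSize c′ ∘ fsuc ∘ fsuc ≗ partSize c ∘ fsuc ∘ fsuc
  partSize-untouched j = cong length (filter-≐ _ _ (c′≡2+⇔c≡2+ j) (allFin k))

  partSize-heads-sum : partSize c′ fzero + partSize c′ (fsuc fzero) ≡ partSize c fzero + partSize c (fsuc fzero)
  partSize-heads-sum = +-cancelʳ-≡ (rest c) _ _ (begin
      (partSize c′ fzero + partSize c′ (fsuc fzero)) + rest c
    ≡⟨ cong (_ +_) (fibreSum-cong (λ _ → fzero) partSize-untouched fzero) ⟨
      (partSize c′ fzero + partSize c′ (fsuc fzero)) + rest c′
    ≡⟨ heads c′ ⟨
      total (partSize c′)
    ≡⟨ trans (total-partSize c′) (sym (total-partSize c)) ⟩
      total (partSize c)
    ≡⟨ heads c ⟩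
      (partSize c fzero + partSize c (fsuc fzero)) + rest c ∎)
    where
    open ≡-Reasoning
    rest : (Fin k → Fin (suc (suc s))) → ℕ
    rest d = total (partSize d ∘ fsuc ∘ fsuc)
    heads : (d : Fin k → Fin (suc (suc s))) → total (partSize d) ≡ (partSize d fzero + partSize d (fsuc fzero)) + rest d
    heads d = begin
        total (partSize d)
      ≡⟨ total-suc (partSize d) ⟩
        partSize d fzero + total (partSize d ∘ fsuc)
      ≡⟨ cong (partSize d fzero +_) (total-suc (partSize d ∘ fsuc)) ⟩
        partSize d fzero + (partSize d (fsuc fzero) + rest d)
      ≡⟨ +-assoc (partSize d fzero) (partSize d (fsuc fzero)) (rest d) ⟨
        (partSize d fzero + partSize d (fsuc fzero)) + rest d ∎

  f-move-≤ : (t : ℕ) → partSize c (fsuc fzero) ≤ partSize c fzero → 1 ≤ partSize c (fsuc fzero) → f c′ t ≤ f c t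
  f-move-≤ t P₂≤P₁ 1≤P₂ = begin
      f c′ t
    ≡⟨ f≡esym c′ t ⟩
      esym (partSize c′) t
    ≤⟨ esym-heads-mono (partSize c) (partSize c′) partSize-untouched partSize-heads-sum products t ⟩
      esym (partSize c) t
    ≡⟨ f≡esym c t ⟨
      f c t ∎
    where
    open ≤-Reasoning
    products : partSize c′ fzero * partSize c′ (fsuc fzero) ≤ partSize c fzero * partSize c (fsuc fzero)
    products = begin
        partSize c′ fzero * partSize c′ (fsuc fzero)
      ≡⟨ trans (cong (partSize c′ fzero *_) partSize-moved) (*-identityʳ _) ⟩
        partSize c′ fzero
      ≤⟨ m+n≡1+b⇒b≤m*n (≤-trans 1≤P₂ P₂≤P₁) 1≤P₂ sizes ⟩
        partSize c fzero * partSize c (fsuc fzero) ∎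
      where
      sizes : partSize c fzero + partSize c (fsuc fzero) ≡ suc (partSize c′ fzero)
      sizes = trans (sym partSize-heads-sum) (trans (cong (partSize c′ fzero +_) partSize-moved) (+-comm _ 1))

lemma4 : (k s t : ℕ) → 2 ≤ t → t ≤ s → s ≤ k →
    (c : Fin k → Fin s) → IsPartition c →
    ((c' : Fin k → Fin (suc s)) → IsPartition c' → Refines c' c → f c t ≤ f c' t)
    ×
    ((i₁ i₂ : Fin s) → toℕ i₁ ≡ 0 → toℕ i₂ ≡ 1 →
      partSize c i₂ ≤ partSize c i₁ → 2 ≤ partSize c i₂ →
      (a : Fin k) → c a ≡ i₂ →
      (c' : Fin k → Fin s) → IsMove c a c' → f c' t ≤ f c t)
lemma4 k s t _ _ _ c _ = (λ c′ → f-refinement-≤ t c c′) , move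
  where
  move : (i₁ i₂ : Fin s) → toℕ i₁ ≡ 0 → toℕ i₂ ≡ 1 → partSize c i₂ ≤ partSize c i₁ → 2 ≤ partSize c i₂ →
    (a : Fin k) → c a ≡ i₂ → (c′ : Fin k → Fin s) → IsMove c a c′ → f c′ t ≤ f c t
  move fzero (fsuc fzero) _ _ P₂≤P₁ 2≤P₂ a ca c′ mv = f-move-≤ c c′ a ca mv t P₂≤P₁ (≤-trans (s≤s z≤n) 2≤P₂)
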